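{- Let $\mathcal{S}$ be a maximum linearly independent split system on a set $X$ with $n\ge3$ elements that satisfies the pairwise separation property. Then, for every $y\in X$, the restriction $\mathcal{S}_{|X-\{y\}}$ is a maximum linearly independent split system on $X-\{y\}$ that satisfies the pairwise separation property.
   Context: A split of a finite set $X$ is a bipartition $\{A,B\}$ of $X$ into two non-empty sets, written $A|B$; a split system on $X$ is a non-empty set of splits. For a split $S=A|B$, $D_S:X\times X\to\mathbb{R}$ is given by $D_S(x,y)=1$ if exactly one of $x,y$ lies in $A$ and $0$ otherwise. $\mathcal{S}$ is linearly independent if $\{D_S:S\in\mathcal{S}\}$ is linearly independent in the real vector space of symmetric maps $X\times X\to\mathbb{R}$ vanishing on the diagonal; it is maximum linearly independent if moreover $|\mathcal{S}|=\binom{|X|}{2}$. For $Y\subseteq X$ the restriction is $\mathcal{S}_{|Y}=\{A\cap Y|B\cap Y: A|B\in\mathcal{S}\}$ (only those with both parts non-empty being splits of $Y$). $\mathcal{S}$ has the pairwise separation property if for any two distinct $x,y\in X$ there exist disjoint (possibly empty) sets $A,B$ with $A\cup B=X-\{x,y\}$ such that each of $A\cup\{x,y\}|B$, $A\cup\{x\}|B\cup\{y\}$, $A\cup\{y\}|B\cup\{x\}$, $A|B\cup\{x,y\}$ that is a split of $X$ (i.e. has both parts non-empty) belongs to $\mathcal{S}$.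
   Formalization: Linear independence of the maps $D_S$ is taken over ℚ, with rational coefficients and values, instead of over ℝ. -}

module Defs where

open import Data.Nat using (ℕ; _≤_)
open import Data.Nat.Combinatorics using (_C_)
open import Data.Bool using (Bool; true; false; if_then_else_; _xor_)
import Data.Bool.Properties as BoolP
open import Data.Fin using (Fin; zero; suc)
open import Data.Fin.Subset using (Subset; _∈_; _⊆_; _∩_; _∪_; _─_; _-_; ⁅_⁆; ∣_∣; Nonempty; ⊥)
open import Data.Fin.Subset.Properties using (nonempty?)
open import Data.Vec using (lookup)
open import Data.Vec.Properties using (≡-dec)
open import Data.List using (List; []; _∷_; length; map; filter; deduplicate)
open import Data.List.Relation.Unary.All using (All)
open import Data.List.Relation.Unary.Any using (Any)
open import Data.Rational using (ℚ; 0ℚ; 1ℚ; _+_; _*_)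
open import Data.Product using (_×_; ∃₂)
open import Data.Sum using (_⊎_)
open import Relation.Nullary using (Dec; ¬_)
open import Relation.Nullary.Decidable using (_×-dec_; _⊎-dec_)
open import Relation.Binary.PropositionalEquality using (_≡_; _≢_)

-- Ground set: X ⊆ Fin N (an arbitrary finite set, up to bijection).
-- A split A|X─A of X is represented by one of its parts A (a subset of X);
-- A and X ─ A represent the same split.

IsSplit : {N : ℕ} → Subset N → Subset N → Set
IsSplit X A = A ⊆ X × Nonempty A × Nonempty (X ─ A)

SameSplit : {N : ℕ} → Subset N → Subset N → Subset N → Set
SameSplit X A B = (A ≡ B) ⊎ (A ≡ X ─ B)

sameSplit? : {N : ℕ} (X A B : Subset N) → Dec (SameSplit X A B)
sameSplit? X A B = ≡-dec BoolP._≟_ A B ⊎-dec ≡-dec BoolP._≟_ A (X ─ B)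

-- A split system is given by a list of representatives; the system itself is
-- the *set* of splits they represent.
SplitSystem : {N : ℕ} → Subset N → List (Subset N) → Set
SplitSystem X L = All (IsSplit X) L × (L ≢ [])

splitSet : {N : ℕ} → Subset N → List (Subset N) → List (Subset N)
splitSet X L = deduplicate (sameSplit? X) L

InSys : {N : ℕ} → Subset N → List (Subset N) → Subset N → Set
InSys X L C = Any (λ S → SameSplit X S C) L

D : {N : ℕ} → Subset N → Fin N → Fin N → ℚ
D A x y = if lookup A x xor lookup A y then 1ℚ else 0ℚ

lincomb : {N : ℕ} (L : List (Subset N)) → (Fin (length L) → ℚ) → Fin N → Fin N → ℚ
lincomb [] c x y = 0ℚ
lincomb (A ∷ L) c x y = c zero * D A x y + lincomb L (λ i → c (suc i)) x y

LinIndep : {N : ℕ} → Subset N → List (Subset N) → Set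
LinIndep X L = (c : Fin (length L) → ℚ) →
  (∀ x y → x ∈ X → y ∈ X → lincomb L c x y ≡ 0ℚ) → ∀ i → c i ≡ 0ℚ

MaxLinIndep : {N : ℕ} → Subset N → List (Subset N) → Set
MaxLinIndep X L = LinIndep X (splitSet X L) × (length (splitSet X L) ≡ ∣ X ∣ C 2)

PairSep : {N : ℕ} → Subset N → List (Subset N) → Set
PairSep X L = ∀ x y → x ∈ X → y ∈ X → x ≢ y →
  ∃₂ λ A B → (A ∩ B ≡ ⊥) × (A ∪ B ≡ (X - x) - y)
    × cond (A ∪ (⁅ x ⁆ ∪ ⁅ y ⁆)) × cond (A ∪ ⁅ x ⁆) × cond (A ∪ ⁅ y ⁆) × cond A
  where
  cond : _ → Set
  cond C = IsSplit X C → InSys X L C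

restrict : {N : ℕ} → Subset N → List (Subset N) → List (Subset N)
restrict Y L = filter (λ C → nonempty? C ×-dec nonempty? (Y ─ C)) (map (_∩ Y) L)

-- Split forms D_S are symmetric forms on X with zero diagonal; these form a space of dimension
-- C(n,2) with basis the pair forms δ_xy (the indicator of the pair {x,y}).  If A witnesses the pairwise
-- separation of x and y, then δ_xy = ½ (D_{A∪x} + D_{A∪y} − D_{A∪x∪y} − D_A), where trivial
-- bipartitions contribute 0 and all others are splits of the system.  Pairwise separation survives
-- restriction to Y = X − y, so the restricted splits span the forms on Y: there are at least
-- C(n−1,2) of them, and at most that many once they are independent.
-- For independence, let Σ c_t D_{R_t} vanish on Y and lift each R_t to a split S_t of X.  The form
-- h = Σ c_t D_{S_t} vanishes on Y × Y, so h = Σ_x h(x,y) δ_xy, which the identity above expands in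
-- the splits separating x from y.  Independence on X identifies the two coefficient vectors.
-- Summing coefficients over the splits of X that restrict to R_t gives c_t on one side and 0 on the
-- other, because A∪x∪y and A∪x (and likewise A∪y and A) have the same restriction to Y.

module Submission where

open import Defs
open import Algebra.Bundles using (Ring)
open import Data.Bool using (Bool; true; false; not; _∧_; _∨_; _xor_; if_then_else_)
import Data.Bool.Properties as BoolP
open import Data.Nat as ℕ using (ℕ; zero; suc; _≤_; _<_; z≤n; s≤s)
import Data.Nat.Properties as ℕP
open import Data.Nat.Combinatorics using (_C_; nC1≡n; nCk+nC[k+1]≡[n+1]C[k+1])
open import Data.Fin as Fin using (Fin; zero; suc; punchIn; _≟_)
import Data.Fin.Properties as FinP
open import Data.Fin.Subset using (Subset; _∈_; _∉_; _⊆_; _∩_; _∪_; _─_; _-_; ⁅_⁆; ⊥; ∣_∣; Nonempty; Empty)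
open import Data.Fin.Subset.Properties
  using ( nonempty?; _∈?_; x∈p∩q⁻; x∈p∩q⁺; x∈p∪q⁻; p∩q⊆p; p∩q⊆q; p⊆p∪q; p─q⊆p; x∈p∧x∉q⇒x∈p─q; x∈p∧x≢y⇒x∈p-y
        ; x∈⁅x⁆; x∈⁅y⁆⇒x≡y; x∉⁅y⁆⇒x≢y; ∉⊥; Empty-unique; ⊆-antisym; ∩-distribʳ-∪; ∪-identityʳ; ∪-assoc
        ; p─q─r≡p─q∪r; p─⊥≡p )
open import Data.Vec using ([]; _∷_; lookup; here; there)
open import Data.Vec.Properties
  using ([]=⇒lookup; lookup⇒[]=; lookup-zipWith; lookup-replicate; tabulate∘lookup; tabulate-cong)
open import Data.Vec.Functional using (insertAt)
open import Data.Vec.Functional.Properties using (insertAt-lookup; insertAt-punchIn)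
open import Data.List as List using (List; []; _∷_; map; _++_; deduplicate; length)
open import Data.List.Properties using (length-map; length-++)
open import Data.List.Membership.Propositional using (find; lose) renaming (_∈_ to _∈ₗ_)
open import Data.List.Membership.Propositional.Properties
  using (∈-lookup; ∈-map⁺; ∈-map⁻; ∈-++⁺ˡ; ∈-++⁺ʳ; ∈-filter⁺; ∈-filter⁻; ∈-deduplicate⁻)
open import Data.List.Relation.Unary.All as All using (All; []; _∷_)
import Data.List.Relation.Unary.All.Properties as AllP
open import Data.List.Relation.Unary.Any as Any using (Any)
import Data.List.Relation.Unary.Any.Properties as AnyP
open import Data.List.Relation.Unary.AllPairs using (AllPairs; []; _∷_)
import Data.List.Relation.Unary.AllPairs.Properties as AllPairsP
open import Data.List.Relation.Unary.Unique.Propositional using (Unique)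
import Data.List.Relation.Unary.Unique.Propositional.Properties as UniqueP
open import Data.Rational using (ℚ; 0ℚ; 1ℚ; _+_; _*_; -_; 1/_; ½; NonZero; ≢-nonZero) renaming (_-_ to _⊖_)
import Data.Rational.Properties as ℚP
open import Data.Rational.Solver using (module +-*-Solver)
open import Algebra.Properties.Group ℚP.+-0-group using (x∙y⁻¹≈ε⇒x≈y; x≈y⇒x∙y⁻¹≈ε)
open import Algebra.Properties.Semiring.Sum (Ring.semiring ℚP.+-*-ring)
  using (sum; sum-cong-≗; sum-replicate-zero; sum-remove; ∑-distrib-+; ∑-comm; *-distribˡ-sum; *-distribʳ-sum)
open import Data.Product using (Σ-syntax; ∃; _×_; _,_; proj₁; proj₂; uncurry)
open import Data.Sum using (_⊎_; inj₁; inj₂; [_,_]′)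
open import Function using (_∘_; case_of_)
open import Function.Bundles using (_⇔_; mk⇔; Equivalence)
open import Relation.Nullary using (¬_; ¬?; Dec; yes; no; does; contradiction)
open import Relation.Nullary.Decidable using (_×-dec_; dec-true; dec-false; does-⇔)
open import Relation.Binary using (tri<; tri≈; tri>)
open import Relation.Binary.PropositionalEquality
open ≡-Reasoning
open +-*-Solver using (solve; _:+_; _:*_; :-_; _:-_; _:=_; con)

private
  variable
    N : ℕ

-- Linear algebra over ℚ

indicator : Bool → ℚ
indicator b = if b then 1ℚ else 0ℚ

sum-zero : ∀ {k} {f : Fin k → ℚ} → (∀ i → f i ≡ 0ℚ) → sum f ≡ 0ℚ
sum-zero {k} f≡0 = trans (sum-cong-≗ f≡0) (sum-replicate-zero k)

infix 7 _·_

_·_ : ∀ {k} → (Fin k → ℚ) → (Fin k → ℚ) → ℚ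
a · b = sum λ i → a i * b i

·-zeroˡ : ∀ {k} (b : Fin k → ℚ) → (λ _ → 0ℚ) · b ≡ 0ℚ
·-zeroˡ b = sum-zero λ i → ℚP.*-zeroˡ (b i)

·-zeroʳ : ∀ {k} (a : Fin k → ℚ) → a · (λ _ → 0ℚ) ≡ 0ℚ
·-zeroʳ a = sum-zero λ i → ℚP.*-zeroʳ (a i)

·-comm : ∀ {k} (a b : Fin k → ℚ) → a · b ≡ b · a
·-comm a b = sum-cong-≗ λ i → ℚP.*-comm (a i) (b i)

·-congˡ : ∀ {k} {a a′ : Fin k → ℚ} (b : Fin k → ℚ) → (∀ i → a i ≡ a′ i) → a · b ≡ a′ · b
·-congˡ b a≡ = sum-cong-≗ λ i → cong (_* b i) (a≡ i)

·-congʳ : ∀ {k} (a : Fin k → ℚ) {b b′ : Fin k → ℚ} → (∀ i → b i ≡ b′ i) → a · b ≡ a · b′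
·-congʳ a b≡ = sum-cong-≗ λ i → cong (a i *_) (b≡ i)

·-*-assoc : ∀ {k} (a b w : Fin k → ℚ) → (λ i → a i * b i) · w ≡ a · (λ i → b i * w i)
·-*-assoc a b w = sum-cong-≗ λ i → ℚP.*-assoc (a i) (b i) (w i)

·-assocˡ : ∀ {k} (s : ℚ) (a w : Fin k → ℚ) → (λ i → s * a i) · w ≡ s * (a · w)
·-assocˡ s a w = trans (sum-cong-≗ λ i → ℚP.*-assoc s (a i) (w i)) (sym (*-distribˡ-sum s (λ i → a i * w i)))

·-distribʳ-+ : ∀ {k} (a b w : Fin k → ℚ) → (λ i → a i + b i) · w ≡ a · w + b · w
·-distribʳ-+ a b w =
  trans (sum-cong-≗ λ i → ℚP.*-distribʳ-+ (w i) (a i) (b i)) (∑-distrib-+ (λ i → a i * w i) (λ i → b i * w i))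

·-negˡ : ∀ {k} (a w : Fin k → ℚ) → (λ i → - a i) · w ≡ - (a · w)
·-negˡ a w = begin
  (λ i → - a i) · w             ≡⟨ ·-congˡ w (λ i → neg-as-scaling (a i)) ⟩
  (λ i → - 1ℚ * a i) · w        ≡⟨ ·-assocˡ (- 1ℚ) a w ⟩
  - 1ℚ * (a · w)                ≡⟨ neg-as-scaling (a · w) ⟨
  - (a · w)                     ∎
  where
  neg-as-scaling : ∀ x → - x ≡ - 1ℚ * x
  neg-as-scaling = solve 1 (λ x → :- x := (:- con 1ℚ) :* x) refl

·-distribʳ-⊖ : ∀ {k} (a b w : Fin k → ℚ) → (λ i → a i ⊖ b i) · w ≡ a · w ⊖ b · w
·-distribʳ-⊖ a b w = trans (·-distribʳ-+ a (λ i → - b i) w) (cong (a · w +_) (·-negˡ b w))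

unit : ∀ {k} → Fin k → Fin k → ℚ
unit j i = indicator (does (j ≟ i))

unit-comm : ∀ {k} (i j : Fin k) → unit i j ≡ unit j i
unit-comm i j = cong indicator (does-⇔ (mk⇔ sym sym) (i ≟ j) (j ≟ i))

unit-· : ∀ {k} (j : Fin k) (f : Fin k → ℚ) → unit j · f ≡ f j
unit-· {suc k} j f = begin
  unit j · f                                                          ≡⟨ sum-remove {i = j} (λ i → unit j i * f i) ⟩
  unit j j * f j + sum (λ i → unit j (punchIn j i) * f (punchIn j i)) ≡⟨ cong₂ _+_ on-diagonal (sum-zero off-diagonal) ⟩
  1ℚ * f j + 0ℚ                                                       ≡⟨ trans (ℚP.+-identityʳ _) (ℚP.*-identityˡ (f j)) ⟩
  f j                                                                 ∎
  where
  on-diagonal : unit j j * f j ≡ 1ℚ * f j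
  on-diagonal = cong (λ b → indicator b * f j) (dec-true (j ≟ j) refl)
  off-diagonal : ∀ i → unit j (punchIn j i) * f (punchIn j i) ≡ 0ℚ
  off-diagonal i =
    trans (cong (λ b → indicator b * f (punchIn j i)) (dec-false (j ≟ punchIn j i) (FinP.punchInᵢ≢i j i ∘ sym)))
          (ℚP.*-zeroˡ (f (punchIn j i)))

quartet : ℚ → ℚ → ℚ → ℚ → ℚ
quartet p q r s = ½ * ((p + q) ⊖ (r + s))

·-quartet : ∀ {k} (a b c d w : Fin k → ℚ) →
  (λ i → quartet (a i) (b i) (c i) (d i)) · w ≡ quartet (a · w) (b · w) (c · w) (d · w)
·-quartet a b c d w = begin
  (λ i → ½ * ((a i + b i) ⊖ (c i + d i))) · w
    ≡⟨ ·-assocˡ ½ (λ i → (a i + b i) ⊖ (c i + d i)) w ⟩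
  ½ * ((λ i → (a i + b i) ⊖ (c i + d i)) · w)
    ≡⟨ cong (½ *_) (·-distribʳ-⊖ (λ i → a i + b i) (λ i → c i + d i) w) ⟩
  ½ * ((λ i → a i + b i) · w ⊖ (λ i → c i + d i) · w)
    ≡⟨ cong₂ (λ x y → ½ * (x ⊖ y)) (·-distribʳ-+ a b w) (·-distribʳ-+ c d w) ⟩
  quartet (a · w) (b · w) (c · w) (d · w) ∎

quartet-cancel : ∀ p q → quartet p q p q ≡ 0ℚ
quartet-cancel p q = trans (cong (½ *_) (ℚP.+-inverseʳ (p + q))) (ℚP.*-zeroʳ ½)

infix 7 _·ᴹ_

_·ᴹ_ : ∀ {k m} → (Fin k → ℚ) → (Fin k → Fin m → ℚ) → Fin m → ℚ
(c ·ᴹ a) j = c · λ i → a i j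

·ᴹ-assoc : ∀ {k m} (c : Fin k → ℚ) (a : Fin k → Fin m → ℚ) (w : Fin m → ℚ) →
  (c ·ᴹ a) · w ≡ c · (λ i → a i · w)
·ᴹ-assoc c a w = begin
  sum (λ j → (c ·ᴹ a) j * w j)                ≡⟨ sum-cong-≗ (λ j → *-distribʳ-sum (w j) (λ i → c i * a i j)) ⟩
  sum (λ j → sum (λ i → c i * a i j * w j))   ≡⟨ ∑-comm (λ i j → c i * a i j * w j) ⟨
  sum (λ i → sum (λ j → c i * a i j * w j))   ≡⟨ sum-cong-≗ (λ i → sum-cong-≗ (λ j → ℚP.*-assoc (c i) (a i j) (w j))) ⟩
  sum (λ i → sum (λ j → c i * (a i j * w j))) ≡⟨ sum-cong-≗ (λ i → *-distribˡ-sum (c i) (λ j → a i j * w j)) ⟨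
  sum (λ i → c i * (a i · w))                 ∎

NontrivialLeftKernel : ∀ {k m} → (Fin k → Fin m → ℚ) → Set
NontrivialLeftKernel {k} a = Σ[ c ∈ (Fin k → ℚ) ] (∀ j → (c ·ᴹ a) j ≡ 0ℚ) × ∃ λ i → ¬ c i ≡ 0ℚ

nontrivialLeftKernel-dropZeroColumn : ∀ {k m} {a : Fin k → Fin (suc m) → ℚ} → (∀ i → a i zero ≡ 0ℚ) →
  NontrivialLeftKernel (λ i j → a i (suc j)) → NontrivialLeftKernel a
nontrivialLeftKernel-dropZeroColumn {a = a} col₀≡0 (c , c·a≡0 , nonzero) = c , c·a≡0′ , nonzero
  where
  c·a≡0′ : ∀ j → (c ·ᴹ a) j ≡ 0ℚ
  c·a≡0′ zero    = sum-zero λ i → trans (cong (c i *_) (col₀≡0 i)) (ℚP.*-zeroʳ (c i))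
  c·a≡0′ (suc j) = c·a≡0 j

-- One step of Gaussian elimination: clear column zero with the pivot row i₀, then drop that row and column.
module PivotElimination {k m} (a : Fin (suc k) → Fin (suc m) → ℚ) (i₀ : Fin (suc k))
                        (pivot≢0 : ¬ a i₀ zero ≡ 0ℚ) where

  private
    instance
      pivot-nonZero : NonZero (a i₀ zero)
      pivot-nonZero = ≢-nonZero pivot≢0

  q : ℚ
  q = 1/ a i₀ zero

  reduced : Fin k → Fin m → ℚ
  reduced i j = a (punchIn i₀ i) (suc j) ⊖ (a (punchIn i₀ i) zero * q) * a i₀ (suc j)

  liftKernel : NontrivialLeftKernel reduced → NontrivialLeftKernel a
  liftKernel (d , d·b≡0 , i , dᵢ≢0) =
    c , c·a≡0 , punchIn i₀ i , λ cᵢ≡0 → dᵢ≢0 (trans (sym (insertAt-punchIn d i₀ c₀ i)) cᵢ≡0)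
    where
    s c₀ : ℚ
    s  = d · λ i → a (punchIn i₀ i) zero
    c₀ = - (s * q)

    c : Fin (suc k) → ℚ
    c = insertAt d i₀ c₀

    c·a-split : ∀ j → (c ·ᴹ a) j ≡ c₀ * a i₀ j + d · (λ i → a (punchIn i₀ i) j)
    c·a-split j = trans (sum-remove {i = i₀} (λ i → c i * a i j))
      (cong₂ _+_ (cong (_* a i₀ j) (insertAt-lookup d i₀ c₀))
                 (sum-cong-≗ λ i → cong (_* a (punchIn i₀ i) j) (insertAt-punchIn d i₀ c₀ i)))

    c·a≡0 : ∀ j → (c ·ᴹ a) j ≡ 0ℚ
    c·a≡0 zero = begin
      (c ·ᴹ a) zero                   ≡⟨ c·a-split zero ⟩
      - (s * q) * a i₀ zero + s       ≡⟨ cleared s q (a i₀ zero) ⟩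
      s * (1ℚ ⊖ q * a i₀ zero)        ≡⟨ cong (λ x → s * (1ℚ ⊖ x)) (ℚP.*-inverseˡ (a i₀ zero)) ⟩
      s * (1ℚ ⊖ 1ℚ)                   ≡⟨ ℚP.*-zeroʳ s ⟩
      0ℚ                              ∎
      where
      cleared : ∀ s q p → - (s * q) * p + s ≡ s * (1ℚ ⊖ q * p)
      cleared = solve 3 (λ s q p → (:- (s :* q)) :* p :+ s := s :* (con 1ℚ :- q :* p)) refl
    c·a≡0 (suc j) = begin
      (c ·ᴹ a) (suc j)                                      ≡⟨ c·a-split (suc j) ⟩
      - (s * q) * a i₀ (suc j) + d · (λ i → a (punchIn i₀ i) (suc j))
        ≡⟨ rearrange s q (a i₀ (suc j)) _ ⟩
      d · (λ i → a (punchIn i₀ i) (suc j)) + - (q * a i₀ (suc j)) * s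
        ≡⟨ cong (d · (λ i → a (punchIn i₀ i) (suc j)) +_)
                (*-distribˡ-sum (- (q * a i₀ (suc j))) (λ i → d i * a (punchIn i₀ i) zero)) ⟩
      d · (λ i → a (punchIn i₀ i) (suc j)) + sum (λ i → - (q * a i₀ (suc j)) * (d i * a (punchIn i₀ i) zero))
        ≡⟨ ∑-distrib-+ (λ i → d i * a (punchIn i₀ i) (suc j)) _ ⟨
      sum (λ i → d i * a (punchIn i₀ i) (suc j) + - (q * a i₀ (suc j)) * (d i * a (punchIn i₀ i) zero))
        ≡⟨ sum-cong-≗ (λ i → distribute (d i) (a (punchIn i₀ i) (suc j)) (a (punchIn i₀ i) zero) q (a i₀ (suc j))) ⟨
      (d ·ᴹ reduced) j                                      ≡⟨ d·b≡0 j ⟩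
      0ℚ                                                    ∎
      where
      rearrange : ∀ s q x t → - (s * q) * x + t ≡ t + - (q * x) * s
      rearrange = solve 4 (λ s q x t → (:- (s :* q)) :* x :+ t := t :+ (:- (q :* x)) :* s) refl
      distribute : ∀ d x y q z → d * (x ⊖ (y * q) * z) ≡ d * x + - (q * z) * (d * y)
      distribute = solve 5 (λ d x y q z → d :* (x :- (y :* q) :* z) := d :* x :+ (:- (q :* z)) :* (d :* y)) refl

nontrivialLeftKernel : ∀ {k} m → m < k → (a : Fin k → Fin m → ℚ) → NontrivialLeftKernel a
nontrivialLeftKernel {suc k} zero _ a = (λ _ → 1ℚ) , (λ ()) , zero , λ ()
nontrivialLeftKernel {suc k} (suc m) (s≤s m<k) a with FinP.all? (λ i → a i zero ℚP.≟ 0ℚ)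
... | yes col₀≡0 = nontrivialLeftKernel-dropZeroColumn {a = a} col₀≡0
                     (nontrivialLeftKernel m (ℕP.m<n⇒m<1+n m<k) (λ i j → a i (suc j)))
... | no col₀≢0 = let i₀ , pivot≢0 = FinP.¬∀⟶∃¬ (suc k) _ (λ i → a i zero ℚP.≟ 0ℚ) col₀≢0
                      open PivotElimination a i₀ pivot≢0
                  in liftKernel (nontrivialLeftKernel m m<k reduced)

module _ {V : Set} where

  lc : ∀ {k} → (Fin k → ℚ) → (Fin k → V → ℚ) → V → ℚ
  lc c u v = c · λ i → u i v

  LinIndepOn : (V → Set) → ∀ {k} → (Fin k → V → ℚ) → Set
  LinIndepOn P {k} u = (c : Fin k → ℚ) → (∀ v → P v → lc c u v ≡ 0ℚ) → ∀ i → c i ≡ 0ℚ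

  InSpanOn : (V → Set) → ∀ {m} → (Fin m → V → ℚ) → (V → ℚ) → Set
  InSpanOn P {m} w f = Σ[ a ∈ (Fin m → ℚ) ] (∀ v → P v → f v ≡ lc a w v)

  linIndep⇒≤ : ∀ {P k m} {u : Fin k → V → ℚ} (a : Fin k → Fin m → ℚ) → LinIndepOn P u →
    (∀ c → (∀ j → (c ·ᴹ a) j ≡ 0ℚ) → ∀ v → P v → lc c u v ≡ 0ℚ) → k ≤ m
  linIndep⇒≤ {k = k} {m} a indep kernel⇒vanishing with m ℕP.<? k
  ... | no m≮k = ℕP.≮⇒≥ m≮k
  ... | yes m<k with nontrivialLeftKernel m m<k a
  ...   | c , c·a≡0 , i , cᵢ≢0 = contradiction (indep c (kernel⇒vanishing c c·a≡0) i) cᵢ≢0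

  linIndep-inSpan⇒≤ : ∀ {P k m} {u : Fin k → V → ℚ} {w : Fin m → V → ℚ} →
    LinIndepOn P u → (∀ i → InSpanOn P w (u i)) → k ≤ m
  linIndep-inSpan⇒≤ {u = u} {w} indep span = linIndep⇒≤ (λ i → proj₁ (span i)) indep λ c c·a≡0 v v∈P → begin
    c · (λ i → u i v)                               ≡⟨ ·-congʳ c (λ i → proj₂ (span i) v v∈P) ⟩
    c · (λ i → proj₁ (span i) · λ j → w j v)        ≡⟨ ·ᴹ-assoc c (λ i → proj₁ (span i)) (λ j → w j v) ⟨
    (c ·ᴹ (λ i → proj₁ (span i))) · (λ j → w j v)   ≡⟨ ·-congˡ (λ j → w j v) c·a≡0 ⟩
    (λ _ → 0ℚ) · (λ j → w j v)                      ≡⟨ ·-zeroˡ (λ j → w j v) ⟩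
    0ℚ                                              ∎

  linIndep-determinedBy⇒≤ : ∀ {P k m} {u : Fin k → V → ℚ} (ps : Fin m → V) → LinIndepOn P u →
    (∀ v → P v → (∀ i → u i v ≡ 0ℚ) ⊎ ∃ λ j → ∀ i → u i v ≡ u i (ps j)) → k ≤ m
  linIndep-determinedBy⇒≤ {u = u} ps indep determined = linIndep⇒≤ (λ i j → u i (ps j)) indep λ c c·a≡0 v v∈P →
    case determined v v∈P of λ where
      (inj₁ u≡0)      → trans (·-congʳ c u≡0) (·-zeroʳ c)
      (inj₂ (j , u≡)) → trans (·-congʳ c u≡) (c·a≡0 j)

  linIndep⇒coefficients-unique : ∀ {P k} {w : Fin k → V → ℚ} {a b : Fin k → ℚ} → LinIndepOn P w →
    (∀ v → P v → lc a w v ≡ lc b w v) → ∀ i → a i ≡ b i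
  linIndep⇒coefficients-unique {P} {w = w} {a} {b} indep same i =
    x∙y⁻¹≈ε⇒x≈y (a i) (b i) (indep (λ i → a i ⊖ b i) difference≡0 i)
    where
    difference≡0 : ∀ v → P v → lc (λ i → a i ⊖ b i) w v ≡ 0ℚ
    difference≡0 v v∈P = trans (·-distribʳ-⊖ a b (λ i → w i v))
      (x≈y⇒x∙y⁻¹≈ε (same v v∈P))

-- Subsets as bit vectors

∈⇒lookup : ∀ {x} {p : Subset N} → x ∈ p → lookup p x ≡ true
∈⇒lookup = []=⇒lookup

lookup⇒∈ : ∀ {x} {p : Subset N} → lookup p x ≡ true → x ∈ p
lookup⇒∈ {x = x} {p} = lookup⇒[]= x p

∉⇒lookup : ∀ {x} {p : Subset N} → x ∉ p → lookup p x ≡ false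
∉⇒lookup {x = x} {p} x∉p with lookup p x in eq
... | true  = contradiction (lookup⇒∈ eq) x∉p
... | false = refl

subset-ext : {p q : Subset N} → (∀ i → lookup p i ≡ lookup q i) → p ≡ q
subset-ext {p = p} {q} p≗q = trans (sym (tabulate∘lookup p)) (trans (tabulate-cong p≗q) (tabulate∘lookup q))

lookup-∩ : ∀ (p q : Subset N) i → lookup (p ∩ q) i ≡ (lookup p i ∧ lookup q i)
lookup-∩ p q i = lookup-zipWith _∧_ i p q

lookup-∪ : ∀ (p q : Subset N) i → lookup (p ∪ q) i ≡ (lookup p i ∨ lookup q i)
lookup-∪ p q i = lookup-zipWith _∨_ i p q

lookup-─ : ∀ (p q : Subset N) i → lookup (p ─ q) i ≡ (lookup p i ∧ not (lookup q i))
lookup-─ p q i with lookup q i in q[i] | lookup-zipWith _ i p q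
... | true  | eq = trans eq (sym (BoolP.∧-zeroʳ (lookup p i)))
... | false | eq = trans eq (sym (BoolP.∧-identityʳ (lookup p i)))

lookup-⊥ : ∀ (i : Fin N) → lookup ⊥ i ≡ false
lookup-⊥ i = lookup-replicate i false

lookup-⁅⁆ : ∀ (x i : Fin N) → lookup ⁅ x ⁆ i ≡ does (x ≟ i)
lookup-⁅⁆ zero    zero    = refl
lookup-⁅⁆ zero    (suc i) = lookup-⊥ i
lookup-⁅⁆ (suc x) zero    = refl
lookup-⁅⁆ (suc x) (suc i) = lookup-⁅⁆ x i

⊆-lookup-false : ∀ {p q : Subset N} → p ⊆ q → ∀ i → lookup q i ≡ false → lookup p i ≡ false
⊆-lookup-false {p = p} p⊆q i q[i]≡false with lookup p i in p[i]
... | true  = trans (sym (∈⇒lookup (p⊆q (lookup⇒∈ p[i])))) q[i]≡false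
... | false = refl

lookup-─-inside : ∀ (Z A : Subset N) {i} → lookup Z i ≡ true → lookup (Z ─ A) i ≡ not (lookup A i)
lookup-─-inside Z A {i} Z[i] = trans (lookup-─ Z A i) (cong (_∧ not (lookup A i)) Z[i])

lookup-─-outside : ∀ (Z A : Subset N) {i} → lookup Z i ≡ false → lookup (Z ─ A) i ≡ false
lookup-─-outside Z A {i} Z[i] = trans (lookup-─ Z A i) (cong (_∧ not (lookup A i)) Z[i])

─-involutive : ∀ {Z A : Subset N} → A ⊆ Z → Z ─ (Z ─ A) ≡ A
─-involutive {Z = Z} {A} A⊆Z = subset-ext pointwise
  where
  pointwise : ∀ i → lookup (Z ─ (Z ─ A)) i ≡ lookup A i
  pointwise i with lookup Z i in Z[i]
  ... | true  = trans (lookup-─-inside Z (Z ─ A) Z[i])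
                      (trans (cong not (lookup-─-inside Z A Z[i])) (BoolP.not-involutive _))
  ... | false = trans (lookup-─-outside Z (Z ─ A) Z[i]) (sym (⊆-lookup-false A⊆Z i Z[i]))

x∈p─q⇒x∉q : ∀ {x} {p q : Subset N} → x ∈ p ─ q → x ∉ q
x∈p─q⇒x∉q {p = _ ∷ p} {_ ∷ q} (there x∈p─q) (there x∈q) = x∈p─q⇒x∉q {p = p} x∈p─q x∈q

x∈p⇒⁅x⁆⊆p : ∀ {x} {Z : Subset N} → x ∈ Z → ⁅ x ⁆ ⊆ Z
x∈p⇒⁅x⁆⊆p x∈Z y∈⁅x⁆ = subst (_∈ _) (sym (x∈⁅y⁆⇒x≡y _ y∈⁅x⁆)) x∈Z

∪-least : ∀ {P Q Z : Subset N} → P ⊆ Z → Q ⊆ Z → P ∪ Q ⊆ Z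
∪-least {P = P} {Q} P⊆Z Q⊆Z x∈ = [ P⊆Z , Q⊆Z ]′ (x∈p∪q⁻ P Q x∈)

p∪q≡r-x-y⇒p⊆r : ∀ {A B X : Subset N} {a b} → A ∪ B ≡ X - a - b → A ⊆ X
p∪q≡r-x-y⇒p⊆r {A = A} {B} {X} {a} {b} A∪B≡ x∈A =
  p─q⊆p X ⁅ a ⁆ (p─q⊆p (X - a) ⁅ b ⁆ (subst (_ ∈_) A∪B≡ (p⊆p∪q B x∈A)))

p⊆q⇒p∩q≡p : ∀ {S Y : Subset N} → S ⊆ Y → S ∩ Y ≡ S
p⊆q⇒p∩q≡p {S = S} {Y} S⊆Y = ⊆-antisym (p∩q⊆p S Y) (λ x∈S → x∈p∩q⁺ (x∈S , S⊆Y x∈S))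

∪-∩-absorb : ∀ (A : Subset N) {S Y} → S ⊆ Y → (A ∪ S) ∩ Y ≡ (A ∩ Y) ∪ S
∪-∩-absorb A {S} {Y} S⊆Y = trans (∩-distribʳ-∪ Y A S) (cong ((A ∩ Y) ∪_) (p⊆q⇒p∩q≡p S⊆Y))

p─r∩q≡q─r : ∀ {X Y : Subset N} (Q : Subset N) → Y ⊆ X → (X ─ Q) ∩ Y ≡ Y ─ Q
p─r∩q≡q─r {X = X} {Y} Q Y⊆X = ⊆-antisym
  (λ x∈ → let x∈X─Q , x∈Y = x∈p∩q⁻ (X ─ Q) Y x∈ in x∈p∧x∉q⇒x∈p─q x∈Y (x∈p─q⇒x∉q x∈X─Q))
  (λ x∈Y─Q → let x∈Y = p─q⊆p Y Q x∈Y─Q in x∈p∩q⁺ (x∈p∧x∉q⇒x∈p─q (Y⊆X x∈Y) (x∈p─q⇒x∉q x∈Y─Q) , x∈Y))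

p─q∩p≡p─q : ∀ (Y B : Subset N) → Y ─ (B ∩ Y) ≡ Y ─ B
p─q∩p≡p─q Y B = ⊆-antisym
  (λ x∈ → x∈p∧x∉q⇒x∈p─q (p─q⊆p Y (B ∩ Y) x∈) λ x∈B → x∈p─q⇒x∉q x∈ (x∈p∩q⁺ (x∈B , p─q⊆p Y (B ∩ Y) x∈)))
  (λ x∈ → x∈p∧x∉q⇒x∈p─q (p─q⊆p Y B x∈) λ x∈B∩Y → x∈p─q⇒x∉q x∈ (proj₁ (x∈p∩q⁻ B Y x∈B∩Y)))

p∪⁅x⁆∩q-x≡p∩q-x : ∀ (P X : Subset N) y → (P ∪ ⁅ y ⁆) ∩ (X - y) ≡ P ∩ (X - y)
p∪⁅x⁆∩q-x≡p∩q-x P X y = trans (∩-distribʳ-∪ (X - y) P ⁅ y ⁆) (trans (cong (P ∩ (X - y) ∪_) ⁅y⁆∩X-y≡⊥) (∪-identityʳ _))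
  where
  ⁅y⁆∩X-y≡⊥ : ⁅ y ⁆ ∩ (X - y) ≡ ⊥
  ⁅y⁆∩X-y≡⊥ = Empty-unique λ (i , i∈) → let i∈⁅y⁆ , i∈X-y = x∈p∩q⁻ ⁅ y ⁆ (X - y) i∈ in x∈p─q⇒x∉q i∈X-y i∈⁅y⁆

Disjoint : Subset N → Subset N → Set
Disjoint P Q = P ∩ Q ≡ ⊥

Disjoint-lookup : ∀ {P Q : Subset N} → Disjoint P Q → ∀ i → (lookup P i ∧ lookup Q i) ≡ false
Disjoint-lookup {P = P} {Q} P∩Q≡⊥ i = trans (sym (lookup-∩ P Q i)) (trans (cong (λ R → lookup R i) P∩Q≡⊥) (lookup-⊥ i))

∉⇒Disjoint-⁅⁆ : ∀ {A : Subset N} {a} → a ∉ A → Disjoint A ⁅ a ⁆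
∉⇒Disjoint-⁅⁆ {A = A} {a} a∉A = Empty-unique λ (i , i∈) →
  let i∈A , i∈⁅a⁆ = x∈p∩q⁻ A ⁅ a ⁆ i∈ in a∉A (subst (_∈ A) (x∈⁅y⁆⇒x≡y a i∈⁅a⁆) i∈A)

≢⇒Disjoint-⁅⁆ : ∀ {a b : Fin N} → a ≢ b → Disjoint ⁅ a ⁆ ⁅ b ⁆
≢⇒Disjoint-⁅⁆ {a = a} {b} a≢b = Empty-unique λ (i , i∈) →
  let i∈⁅a⁆ , i∈⁅b⁆ = x∈p∩q⁻ ⁅ a ⁆ ⁅ b ⁆ i∈ in a≢b (trans (sym (x∈⁅y⁆⇒x≡y a i∈⁅a⁆)) (x∈⁅y⁆⇒x≡y b i∈⁅b⁆))

-- Splits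

SameSplit-sym : ∀ {Z A B : Subset N} → B ⊆ Z → SameSplit Z A B → SameSplit Z B A
SameSplit-sym B⊆Z (inj₁ A≡B)    = inj₁ (sym A≡B)
SameSplit-sym B⊆Z (inj₂ refl)   = inj₂ (sym (─-involutive B⊆Z))

SameSplit-trans : ∀ {Z A B T : Subset N} → T ⊆ Z → SameSplit Z A B → SameSplit Z B T → SameSplit Z A T
SameSplit-trans T⊆Z (inj₁ refl) B~T         = B~T
SameSplit-trans T⊆Z (inj₂ refl) (inj₁ refl) = inj₂ refl
SameSplit-trans T⊆Z (inj₂ refl) (inj₂ refl) = inj₁ (─-involutive T⊆Z)

SameSplit-transfer : ∀ {Z A B T : Subset N} → B ⊆ Z → T ⊆ Z → SameSplit Z A B → SameSplit Z A T ⇔ SameSplit Z B T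
SameSplit-transfer B⊆Z T⊆Z A~B = mk⇔ (λ A~T → SameSplit-trans T⊆Z (SameSplit-sym B⊆Z A~B) A~T)
                                     (λ B~T → SameSplit-trans T⊆Z A~B B~T)

SameSplit-∩ : ∀ {X Y A B : Subset N} → Y ⊆ X → SameSplit X A B → SameSplit Y (A ∩ Y) (B ∩ Y)
SameSplit-∩ Y⊆X (inj₁ refl) = inj₁ refl
SameSplit-∩ {Y = Y} {B = B} Y⊆X (inj₂ refl) = inj₂ (trans (p─r∩q≡q─r B Y⊆X) (sym (p─q∩p≡p─q Y B)))

Trivial : Subset N → Subset N → Set
Trivial Z A = Empty A ⊎ Empty (Z ─ A)

Trivial⇒¬IsSplit : ∀ {Z A : Subset N} → Trivial Z A → ¬ IsSplit Z A
Trivial⇒¬IsSplit (inj₁ A-empty)  (_ , A-nonempty , _)  = A-empty A-nonempty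
Trivial⇒¬IsSplit (inj₂ ZA-empty) (_ , _ , ZA-nonempty) = ZA-empty ZA-nonempty

isSplit-or-trivial : ∀ (Z A : Subset N) → A ⊆ Z → IsSplit Z A ⊎ Trivial Z A
isSplit-or-trivial Z A A⊆Z with nonempty? A | nonempty? (Z ─ A)
... | yes A-nonempty | yes ZA-nonempty = inj₁ (A⊆Z , A-nonempty , ZA-nonempty)
... | no A-empty     | _               = inj₂ (inj₁ A-empty)
... | yes _          | no ZA-empty     = inj₂ (inj₂ ZA-empty)

IsSplit-SameSplit : ∀ {Z A B : Subset N} → B ⊆ Z → SameSplit Z A B → IsSplit Z A → IsSplit Z B
IsSplit-SameSplit B⊆Z (inj₁ refl) A-split = A-split
IsSplit-SameSplit {Z = Z} {B = B} B⊆Z (inj₂ refl) (_ , ZB-nonempty , ZZB-nonempty) =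
  B⊆Z , subst Nonempty (─-involutive B⊆Z) ZZB-nonempty , ZB-nonempty

Trivial-∩ : ∀ {X Y A : Subset N} → Y ⊆ X → Trivial X A → Trivial Y (A ∩ Y)
Trivial-∩ {A = A} Y⊆X (inj₁ A-empty) = inj₁ λ (i , i∈A∩Y) → A-empty (i , proj₁ (x∈p∩q⁻ A _ i∈A∩Y))
Trivial-∩ {X = X} {Y} {A} Y⊆X (inj₂ XA-empty) = inj₂ λ (i , i∈) →
  XA-empty (i , p∩q⊆p (X ─ A) Y (subst (i ∈_) (trans (p─q∩p≡p─q Y A) (sym (p─r∩q≡q─r A Y⊆X))) i∈))

IsSplit-∩⇒IsSplit : ∀ {X Y A : Subset N} → Y ⊆ X → A ⊆ X → IsSplit Y (A ∩ Y) → IsSplit X A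
IsSplit-∩⇒IsSplit {X = X} {Y} {A} Y⊆X A⊆X A∩Y-split with isSplit-or-trivial X A A⊆X
... | inj₁ A-split  = A-split
... | inj₂ A-trivial = contradiction A∩Y-split (Trivial⇒¬IsSplit (Trivial-∩ Y⊆X A-trivial))

D-sym : ∀ (A : Subset N) x y → D A x y ≡ D A y x
D-sym A x y = cong indicator (BoolP.xor-comm (lookup A x) (lookup A y))

D-diag : ∀ (A : Subset N) x → D A x x ≡ 0ℚ
D-diag A x = cong indicator (BoolP.xor-same (lookup A x))

D-SameSplit : ∀ {Z A B : Subset N} → SameSplit Z A B → ∀ {x y} → x ∈ Z → y ∈ Z → D A x y ≡ D B x y
D-SameSplit (inj₁ refl) x∈Z y∈Z = refl
D-SameSplit {Z = Z} {B = B} (inj₂ refl) {x} {y} x∈Z y∈Z = cong indicator (begin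
  lookup (Z ─ B) x xor lookup (Z ─ B) y
    ≡⟨ cong₂ _xor_ (lookup-─-inside Z B (∈⇒lookup x∈Z)) (lookup-─-inside Z B (∈⇒lookup y∈Z)) ⟩
  not (lookup B x) xor not (lookup B y)  ≡⟨ not-xor-not (lookup B x) (lookup B y) ⟩
  lookup B x xor lookup B y              ∎)
  where
  not-xor-not : ∀ a b → not a xor not b ≡ a xor b
  not-xor-not true  b = refl
  not-xor-not false b = BoolP.not-involutive b

D-∩ : ∀ (A : Subset N) {Y x y} → x ∈ Y → y ∈ Y → D (A ∩ Y) x y ≡ D A x y
D-∩ A {Y} {x} {y} x∈Y y∈Y = cong indicator (cong₂ _xor_ (restrict-at x∈Y) (restrict-at y∈Y))
  where
  restrict-at : ∀ {i} → i ∈ Y → lookup (A ∩ Y) i ≡ lookup A i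
  restrict-at {i} i∈Y = trans (lookup-∩ A Y i) (trans (cong (lookup A i ∧_) (∈⇒lookup i∈Y)) (BoolP.∧-identityʳ _))

D-Trivial : ∀ {Z A : Subset N} → Trivial Z A → ∀ {x y} → x ∈ Z → y ∈ Z → D A x y ≡ 0ℚ
D-Trivial {A = A} (inj₁ A-empty) {x} {y} _ _ =
  cong indicator (cong₂ _xor_ (∉⇒lookup λ x∈A → A-empty (x , x∈A)) (∉⇒lookup λ y∈A → A-empty (y , y∈A)))
D-Trivial {Z = Z} {A} (inj₂ ZA-empty) {x} {y} x∈Z y∈Z =
  cong indicator (cong₂ _xor_ (inside-A x∈Z) (inside-A y∈Z))
  where
  inside-A : ∀ {i} → i ∈ Z → lookup A i ≡ true
  inside-A {i} i∈Z with lookup A i in A[i]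
  ... | true  = refl
  ... | false = contradiction (i , lookup⇒∈ (trans (lookup-─-inside Z A (∈⇒lookup i∈Z)) (cong not A[i]))) ZA-empty

-- Split forms and pair forms

Form : ℕ → Set
Form N = Fin N × Fin N → ℚ

_∈²_ : Fin N × Fin N → Subset N → Set
p ∈² Z = proj₁ p ∈ Z × proj₂ p ∈ Z

splitForm : Subset N → Form N
splitForm A p = D A (proj₁ p) (proj₂ p)

crossIndicator : Subset N → Subset N → Fin N → Fin N → ℚ
crossIndicator P Q u v = indicator ((lookup P u ∧ lookup Q v) ∨ (lookup Q u ∧ lookup P v))

pairForm : Fin N → Fin N → Form N
pairForm x y p = crossIndicator ⁅ x ⁆ ⁅ y ⁆ (proj₁ p) (proj₂ p)

data AtMostOne : Bool → Bool → Bool → Set where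
  first  : AtMostOne true false false
  second : AtMostOne false true false
  third  : AtMostOne false false true
  none   : AtMostOne false false false

atMostOne : ∀ a b c → (a ∧ b) ≡ false → (a ∧ c) ≡ false → (b ∧ c) ≡ false → AtMostOne a b c
atMostOne true  false false _ _ _ = first
atMostOne false true  false _ _ _ = second
atMostOne false false true  _ _ _ = third
atMostOne false false false _ _ _ = none
atMostOne true  true  _     () _ _
atMostOne true  false true  _ () _
atMostOne false true  true  _ _ ()

quartet-xor : ∀ {a b c a′ b′ c′} → AtMostOne a b c → AtMostOne a′ b′ c′ →
  quartet (indicator ((a ∨ b) xor (a′ ∨ b′))) (indicator ((a ∨ c) xor (a′ ∨ c′)))
          (indicator ((a ∨ (b ∨ c)) xor (a′ ∨ (b′ ∨ c′)))) (indicator (a xor a′))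
    ≡ indicator ((b ∧ c′) ∨ (c ∧ b′))
quartet-xor first  first  = refl
quartet-xor first  second = refl
quartet-xor first  third  = refl
quartet-xor first  none   = refl
quartet-xor second first  = refl
quartet-xor second second = refl
quartet-xor second third  = refl
quartet-xor second none   = refl
quartet-xor third  first  = refl
quartet-xor third  second = refl
quartet-xor third  third  = refl
quartet-xor third  none   = refl
quartet-xor none   first  = refl
quartet-xor none   second = refl
quartet-xor none   third  = refl
quartet-xor none   none   = refl

quartet-D : ∀ {A P Q : Subset N} → Disjoint A P → Disjoint A Q → Disjoint P Q → ∀ u v →
  quartet (D (A ∪ P) u v) (D (A ∪ Q) u v) (D (A ∪ (P ∪ Q)) u v) (D A u v) ≡ crossIndicator P Q u v
quartet-D {A = A} {P} {Q} A∩P A∩Q P∩Q u v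
  rewrite lookup-∪ A P u | lookup-∪ A P v | lookup-∪ A Q u | lookup-∪ A Q v
        | lookup-∪ A (P ∪ Q) u | lookup-∪ A (P ∪ Q) v | lookup-∪ P Q u | lookup-∪ P Q v
  = quartet-xor (region u) (region v)
  where
  region : ∀ i → AtMostOne (lookup A i) (lookup P i) (lookup Q i)
  region i = atMostOne _ _ _ (Disjoint-lookup A∩P i) (Disjoint-lookup A∩Q i) (Disjoint-lookup P∩Q i)

does-∧-false : ∀ {P Q : Set} (P? : Dec P) (Q? : Dec Q) → ¬ (P × Q) → (does P? ∧ does Q?) ≡ false
does-∧-false (yes p) (yes q) ¬p×q = contradiction (p , q) ¬p×q
does-∧-false (yes _) (no _)  _    = refl
does-∧-false (no _)  _       _    = refl

pairForm-self : ∀ (a b : Fin N) → pairForm a b (a , b) ≡ 1ℚ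
pairForm-self a b = cong indicator (cong (_∨ (lookup ⁅ b ⁆ a ∧ lookup ⁅ a ⁆ b)) (cong₂ _∧_ (self a) (self b)))
  where self : ∀ i → lookup ⁅ i ⁆ i ≡ true
        self i = trans (lookup-⁅⁆ i i) (dec-true (i ≟ i) refl)

pairForm-other : ∀ {a b c d : Fin N} → ¬ (c ≡ a × d ≡ b) → ¬ (d ≡ a × c ≡ b) → pairForm c d (a , b) ≡ 0ℚ
pairForm-other {a = a} {b} {c} {d} ¬same ¬swapped = cong indicator (cong₂ _∨_
  (trans (cong₂ _∧_ (lookup-⁅⁆ c a) (lookup-⁅⁆ d b)) (does-∧-false (c ≟ a) (d ≟ b) ¬same))
  (trans (cong₂ _∧_ (lookup-⁅⁆ d a) (lookup-⁅⁆ c b)) (does-∧-false (d ≟ a) (c ≟ b) ¬swapped)))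

pairForm-sym : ∀ (x y u v : Fin N) → pairForm x y (u , v) ≡ pairForm x y (v , u)
pairForm-sym x y u v = cong indicator
  (trans (BoolP.∨-comm (lookup ⁅ x ⁆ u ∧ lookup ⁅ y ⁆ v) (lookup ⁅ y ⁆ u ∧ lookup ⁅ x ⁆ v))
  (cong₂ _∨_ (BoolP.∧-comm (lookup ⁅ y ⁆ u) (lookup ⁅ x ⁆ v)) (BoolP.∧-comm (lookup ⁅ x ⁆ u) (lookup ⁅ y ⁆ v))))

pairForm-at : ∀ {x y v : Fin N} → y ≢ v → pairForm x y (y , v) ≡ unit v x
pairForm-at {x = x} {y} {v} y≢v with v ≟ x
... | yes refl = trans (pairForm-sym v y y v) (pairForm-self v y)
... | no v≢x   = pairForm-other (y≢v ∘ proj₂) (v≢x ∘ sym ∘ proj₂)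

∈-- : ∀ {X : Subset N} {y u} → u ∈ X → y ≢ u → u ∈ X - y
∈-- u∈X y≢u = x∈p∧x≢y⇒x∈p-y u∈X (λ u≡y → y≢u (sym u≡y))

module _ (X : Subset N) (y : Fin N) (h : Form N) (h-sym : ∀ u v → h (u , v) ≡ h (v , u))
         (h-diag : ∀ u → h (u , u) ≡ 0ℚ) where

  private
    w : Fin N → ℚ
    w x = h (x , y) * indicator (lookup (X - y) x)

    at-y : ∀ {v} → v ∈ X → y ≢ v → h (y , v) ≡ lc w (λ x → pairForm x y) (y , v)
    at-y {v} v∈X y≢v = begin
      h (y , v)                                ≡⟨ h-sym y v ⟩
      h (v , y)                                ≡⟨ ℚP.*-identityʳ (h (v , y)) ⟨
      h (v , y) * 1ℚ                           ≡⟨ cong (λ b → h (v , y) * indicator b) (∈⇒lookup (∈-- v∈X y≢v)) ⟨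
      w v                                      ≡⟨ trans (·-comm w (unit v)) (unit-· v w) ⟨
      w · unit v                               ≡⟨ ·-congʳ w (λ x → pairForm-at y≢v) ⟨
      lc w (λ x → pairForm x y) (y , v)        ∎

    diagonal-term : ∀ x → w x * pairForm x y (y , y) ≡ 0ℚ
    diagonal-term x with x ≟ y
    ... | yes refl = trans (cong (_* pairForm x y (y , y)) w≡0) (ℚP.*-zeroˡ (pairForm x y (y , y)))
      where
      w≡0 : w x ≡ 0ℚ
      w≡0 = trans (cong (_* indicator (lookup (X - y) x)) (h-diag x)) (ℚP.*-zeroˡ (indicator (lookup (X - y) x)))
    ... | no x≢y = trans (cong (w x *_) (pairForm-other {a = y} {y} {x} {y} (x≢y ∘ proj₁) (x≢y ∘ proj₂))) (ℚP.*-zeroʳ (w x))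

  form-decomposition : (∀ p → p ∈² (X - y) → h p ≡ 0ℚ) →
    ∀ p → p ∈² X → h p ≡ lc (λ x → h (x , y) * indicator (lookup (X - y) x)) (λ x → pairForm x y) p
  form-decomposition h-vanishes (u , v) (u∈X , v∈X) with y ≟ u | y ≟ v
  ... | no y≢u   | no y≢v   = trans (h-vanishes (u , v) (∈-- u∈X y≢u , ∈-- v∈X y≢v)) (sym (trans
                                (·-congʳ w (λ x → pairForm-other {a = u} {v} {x} {y} (y≢v ∘ proj₂) (y≢u ∘ proj₁)))
                                (·-zeroʳ w)))
  ... | yes refl | no y≢v   = at-y v∈X y≢v
  ... | no y≢u   | yes refl = trans (h-sym u y) (trans (at-y u∈X y≢u) (·-congʳ w λ x → pairForm-sym x y y u))
  ... | yes refl | yes refl = trans (h-diag y) (sym (sum-zero {f = λ x → w x * pairForm x y (y , y)} diagonal-term))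

-- Ordered pairs of a subset

module _ {A : Set} {R : A → A → Set} (R? : ∀ x y → Dec (R x y)) where

  deduplicate-pairwiseDistinct : ∀ xs → AllPairs (λ a b → ¬ R a b) (deduplicate R? xs)
  deduplicate-pairwiseDistinct []       = []
  deduplicate-pairwiseDistinct (x ∷ xs) =
    AllP.all-filter (¬? ∘ R? x) (deduplicate R? xs) ∷ AllPairsP.filter⁺ (¬? ∘ R? x) (deduplicate-pairwiseDistinct xs)

AllPairs-lookup : ∀ {A : Set} {R : A → A → Set} {xs : List A} → AllPairs R xs → ∀ {i j} → i ≢ j →
  R (List.lookup xs i) (List.lookup xs j) ⊎ R (List.lookup xs j) (List.lookup xs i)
AllPairs-lookup (_ ∷ _)        {zero}  {zero}  i≢j = contradiction refl i≢j
AllPairs-lookup (Rx ∷ _)       {zero}  {suc j} _   = inj₁ (All.lookup Rx (∈-lookup j))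
AllPairs-lookup (Rx ∷ _)       {suc i} {zero}  _   = inj₂ (All.lookup Rx (∈-lookup i))
AllPairs-lookup (_ ∷ distinct) {suc i} {suc j} i≢j = AllPairs-lookup distinct (i≢j ∘ cong suc)

Unique-lookup-injective : ∀ {A : Set} {xs : List A} → Unique xs → ∀ {i j} → List.lookup xs i ≡ List.lookup xs j → i ≡ j
Unique-lookup-injective unique {i} {j} xᵢ≡xⱼ with i ≟ j
... | yes i≡j = i≡j
... | no i≢j with AllPairs-lookup unique i≢j
...   | inj₁ xᵢ≢xⱼ = contradiction xᵢ≡xⱼ xᵢ≢xⱼ
...   | inj₂ xⱼ≢xᵢ = contradiction (sym xᵢ≡xⱼ) xⱼ≢xᵢ

elements : Subset N → List (Fin N)
elements []          = []
elements (true ∷ Z)  = zero ∷ map suc (elements Z)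
elements (false ∷ Z) = map suc (elements Z)

length-elements : ∀ (Z : Subset N) → length (elements Z) ≡ ∣ Z ∣
length-elements []          = refl
length-elements (true ∷ Z)  = cong suc (trans (length-map suc (elements Z)) (length-elements Z))
length-elements (false ∷ Z) = trans (length-map suc (elements Z)) (length-elements Z)

∈-elements⁺ : ∀ {Z : Subset N} {i} → i ∈ Z → i ∈ₗ elements Z
∈-elements⁺ {Z = true ∷ Z}  here        = Any.here refl
∈-elements⁺ {Z = true ∷ Z}  (there i∈Z) = Any.there (∈-map⁺ suc (∈-elements⁺ i∈Z))
∈-elements⁺ {Z = false ∷ Z} (there i∈Z) = ∈-map⁺ suc (∈-elements⁺ i∈Z)

elements-sound : ∀ (Z : Subset N) → All (_∈ Z) (elements Z)
elements-sound []          = []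
elements-sound (true ∷ Z)  = here ∷ AllP.map⁺ (All.map there (elements-sound Z))
elements-sound (false ∷ Z) = AllP.map⁺ (All.map there (elements-sound Z))

elements-unique : ∀ (Z : Subset N) → Unique (elements Z)
elements-unique []          = []
elements-unique (true ∷ Z)  =
  AllP.map⁺ (All.universal (λ _ ()) (elements Z)) ∷ UniqueP.map⁺ FinP.suc-injective (elements-unique Z)
elements-unique (false ∷ Z) = UniqueP.map⁺ FinP.suc-injective (elements-unique Z)

sucPair : Fin N × Fin N → Fin (suc N) × Fin (suc N)
sucPair (a , b) = suc a , suc b

sucPair-injective : ∀ {p q : Fin N × Fin N} → sucPair p ≡ sucPair q → p ≡ q
sucPair-injective {p = _ , _} {_ , _} refl = refl

pairWithZero : Fin N → Fin (suc N) × Fin (suc N)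
pairWithZero j = zero , suc j

pairWithZero-injective : ∀ {i j : Fin N} → pairWithZero i ≡ pairWithZero j → i ≡ j
pairWithZero-injective refl = refl

pairs : Subset N → List (Fin N × Fin N)
pairs []          = []
pairs (true ∷ Z)  = map pairWithZero (elements Z) ++ map sucPair (pairs Z)
pairs (false ∷ Z) = map sucPair (pairs Z)

length-pairs : ∀ (Z : Subset N) → length (pairs Z) ≡ ∣ Z ∣ C 2
length-pairs []          = refl
length-pairs (true ∷ Z)  = begin
  length (map pairWithZero (elements Z) ++ map sucPair (pairs Z))
    ≡⟨ length-++ (map pairWithZero (elements Z)) ⟩
  length (map pairWithZero (elements Z)) ℕ.+ length (map sucPair (pairs Z))
    ≡⟨ cong₂ ℕ._+_ (trans (length-map pairWithZero (elements Z)) (length-elements Z))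
                 (trans (length-map sucPair (pairs Z)) (length-pairs Z)) ⟩
  ∣ Z ∣ ℕ.+ ∣ Z ∣ C 2        ≡⟨ cong (ℕ._+ ∣ Z ∣ C 2) (nC1≡n ∣ Z ∣) ⟨
  ∣ Z ∣ C 1 ℕ.+ ∣ Z ∣ C 2    ≡⟨ nCk+nC[k+1]≡[n+1]C[k+1] ∣ Z ∣ 1 ⟩
  suc ∣ Z ∣ C 2            ∎
length-pairs (false ∷ Z) = trans (length-map sucPair (pairs Z)) (length-pairs Z)

∈-pairs⁺ : ∀ {Z : Subset N} {a b} → a ∈ Z → b ∈ Z → a Fin.< b → (a , b) ∈ₗ pairs Z
∈-pairs⁺ {Z = true ∷ Z}  here        (there b∈Z) _       = ∈-++⁺ˡ (∈-map⁺ pairWithZero (∈-elements⁺ b∈Z))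
∈-pairs⁺ {Z = true ∷ Z}  (there a∈Z) (there b∈Z) (s≤s a<b) =
  ∈-++⁺ʳ (map pairWithZero (elements Z)) (∈-map⁺ sucPair (∈-pairs⁺ a∈Z b∈Z a<b))
∈-pairs⁺ {Z = false ∷ Z} (there a∈Z) (there b∈Z) (s≤s a<b) = ∈-map⁺ sucPair (∈-pairs⁺ a∈Z b∈Z a<b)

OrderedPairIn : Subset N → Fin N × Fin N → Set
OrderedPairIn Z (a , b) = a ∈ Z × b ∈ Z × a Fin.< b

pairs-sound : ∀ (Z : Subset N) → All (OrderedPairIn Z) (pairs Z)
pairs-sound []          = []
pairs-sound (true ∷ Z)  = AllP.++⁺ (AllP.map⁺ (All.map (λ b∈Z → here , there b∈Z , s≤s z≤n) (elements-sound Z)))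
                                  (AllP.map⁺ (All.map shift (pairs-sound Z)))
  where shift : ∀ {p} → OrderedPairIn Z p → OrderedPairIn (true ∷ Z) (sucPair p)
        shift {_ , _} (a∈Z , b∈Z , a<b) = there a∈Z , there b∈Z , s≤s a<b
pairs-sound (false ∷ Z) = AllP.map⁺ (All.map shift (pairs-sound Z))
  where shift : ∀ {p} → OrderedPairIn Z p → OrderedPairIn (false ∷ Z) (sucPair p)
        shift {_ , _} (a∈Z , b∈Z , a<b) = there a∈Z , there b∈Z , s≤s a<b

pairs-unique : ∀ (Z : Subset N) → Unique (pairs Z)
pairs-unique []          = []
pairs-unique (true ∷ Z)  = UniqueP.++⁺ (UniqueP.map⁺ pairWithZero-injective (elements-unique Z))
                                        (UniqueP.map⁺ sucPair-injective (pairs-unique Z)) disjoint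
  where
  disjoint : ∀ {p} → ¬ (p ∈ₗ map pairWithZero (elements Z) × p ∈ₗ map sucPair (pairs Z))
  disjoint (p∈₁ , p∈₂) with ∈-map⁻ pairWithZero p∈₁ | ∈-map⁻ sucPair p∈₂
  ... | _ , _ , refl | (_ , _) , _ , ()
pairs-unique (false ∷ Z) = UniqueP.map⁺ sucPair-injective (pairs-unique Z)

pairs-cover : ∀ {Z : Subset N} {u v} → u ∈ Z → v ∈ Z → u ≢ v →
  ∃ λ j → List.lookup (pairs Z) j ≡ (u , v) ⊎ List.lookup (pairs Z) j ≡ (v , u)
pairs-cover {u = u} {v} u∈Z v∈Z u≢v with FinP.<-cmp u v
... | tri< u<v _ _ = let uv∈ = ∈-pairs⁺ u∈Z v∈Z u<v in Any.index uv∈ , inj₁ (sym (AnyP.lookup-index uv∈))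
... | tri≈ _ u≡v _ = contradiction u≡v u≢v
... | tri> _ _ v<u = let vu∈ = ∈-pairs⁺ v∈Z u∈Z v<u in Any.index vu∈ , inj₂ (sym (AnyP.lookup-index vu∈))

pairForms : (Z : Subset N) → Fin (length (pairs Z)) → Form N
pairForms Z j = uncurry pairForm (List.lookup (pairs Z) j)

pairForms-linIndep : ∀ (Z : Subset N) → LinIndepOn (_∈² Z) (pairForms Z)
pairForms-linIndep Z c vanish k = begin
  c k                                       ≡⟨ unit-· k c ⟨
  unit k · c                                ≡⟨ ·-comm (unit k) c ⟩
  c · unit k                                ≡⟨ ·-congʳ c evaluate ⟨
  lc c (pairForms Z) (List.lookup (pairs Z) k) ≡⟨ vanish _ (proj₁ (ordered k) , proj₁ (proj₂ (ordered k))) ⟩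
  0ℚ                                        ∎
  where
  ordered : ∀ j → OrderedPairIn Z (List.lookup (pairs Z) j)
  ordered j = All.lookup (pairs-sound Z) (∈-lookup j)
  evaluate : ∀ j → pairForms Z j (List.lookup (pairs Z) k) ≡ unit k j
  evaluate j with k ≟ j
  ... | yes refl = pairForm-self (proj₁ (List.lookup (pairs Z) k)) (proj₂ (List.lookup (pairs Z) k))
  ... | no k≢j = pairForm-other
        (λ (c≡a , d≡b) → k≢j (sym (Unique-lookup-injective (pairs-unique Z) (cong₂ _,_ c≡a d≡b))))
        (λ (d≡a , c≡b) → FinP.<-asym (proj₂ (proj₂ (ordered k))) (subst₂ Fin._<_ c≡b d≡a (proj₂ (proj₂ (ordered j)))))

symmetricForms-linIndep⇒≤ : ∀ {Z : Subset N} {k} {u : Fin k → Form N} → LinIndepOn (_∈² Z) u →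
  (∀ i x y → u i (x , y) ≡ u i (y , x)) → (∀ i x → u i (x , x) ≡ 0ℚ) → k ≤ ∣ Z ∣ C 2
symmetricForms-linIndep⇒≤ {Z = Z} {u = u} indep u-sym u-diag =
  subst (_ ≤_) (length-pairs Z) (linIndep-determinedBy⇒≤ (List.lookup (pairs Z)) indep determined)
  where
  determined : ∀ p → p ∈² Z → (∀ i → u i p ≡ 0ℚ) ⊎ ∃ λ j → ∀ i → u i p ≡ u i (List.lookup (pairs Z) j)
  determined (x , y) (x∈Z , y∈Z) with x ≟ y
  ... | yes refl = inj₁ λ i → u-diag i x
  ... | no x≢y with pairs-cover x∈Z y∈Z x≢y
  ...   | j , inj₁ pⱼ≡xy = inj₂ (j , λ i → cong (u i) (sym pⱼ≡xy))
  ...   | j , inj₂ pⱼ≡yx = inj₂ (j , λ i → trans (u-sym i x y) (cong (u i) (sym pⱼ≡yx)))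

pairForms-inSpan⇒≤ : ∀ {Z : Subset N} {m} {w : Fin m → Form N} →
  (∀ {a b} → a ∈ Z → b ∈ Z → a ≢ b → InSpanOn (_∈² Z) w (pairForm a b)) → ∣ Z ∣ C 2 ≤ m
pairForms-inSpan⇒≤ {Z = Z} pairForm∈span = subst (_≤ _) (length-pairs Z)
  (linIndep-inSpan⇒≤ (pairForms-linIndep Z) λ j →
    let a∈Z , b∈Z , a<b = All.lookup (pairs-sound Z) (∈-lookup j)
    in pairForm∈span a∈Z b∈Z (FinP.<⇒≢ a<b))

-- Split systems and their restrictions

lincomb≡lc : ∀ (L : List (Subset N)) c x y → lincomb L c x y ≡ lc c (λ i → splitForm (List.lookup L i)) (x , y)
lincomb≡lc List.[]      c x y = refl
lincomb≡lc (A List.∷ L) c x y = cong (c Fin.zero * D A x y +_) (lincomb≡lc L (λ i → c (Fin.suc i)) x y)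

module _ (Z : Subset N) (L : List (Subset N)) where

  splitSet-complete : ∀ {P} → P ⊆ Z → InSys Z L P → ∃ λ i → SameSplit Z (List.lookup (splitSet Z L) i) P
  splitSet-complete {P} P⊆Z P∈L = Any.index P∈S , AnyP.lookup-index P∈S
    where
    P∈S : Any (λ S → SameSplit Z S P) (splitSet Z L)
    P∈S = AnyP.deduplicate⁺ (sameSplit? Z) (λ y~x x~P → SameSplit-trans P⊆Z y~x x~P) P∈L

  splitSet-distinct : All (_⊆ Z) L → ∀ {i j} →
    SameSplit Z (List.lookup (splitSet Z L) i) (List.lookup (splitSet Z L) j) → i ≡ j
  splitSet-distinct L⊆Z {i} {j} Sᵢ~Sⱼ with i ≟ j
  ... | yes i≡j = i≡j
  ... | no i≢j with AllPairs-lookup (deduplicate-pairwiseDistinct (sameSplit? Z) L) i≢j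
  ...   | inj₁ Sᵢ≁Sⱼ = contradiction Sᵢ~Sⱼ Sᵢ≁Sⱼ
  ...   | inj₂ Sⱼ≁Sᵢ = contradiction (SameSplit-sym (All.lookup S⊆Z (∈-lookup j)) Sᵢ~Sⱼ) Sⱼ≁Sᵢ
    where
    S⊆Z : All (_⊆ Z) (splitSet Z L)
    S⊆Z = AllP.deduplicate⁺ (sameSplit? Z) L⊆Z

  splitForms : Fin (length (splitSet Z L)) → Form N
  splitForms i = splitForm (List.lookup (splitSet Z L) i)

  LinIndep⇒LinIndepOn : LinIndep Z (splitSet Z L) → LinIndepOn (_∈² Z) splitForms
  LinIndep⇒LinIndepOn indep c vanish = indep c λ x y x∈Z y∈Z →
    trans (lincomb≡lc (splitSet Z L) c x y) (vanish (x , y) (x∈Z , y∈Z))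

  LinIndepOn⇒LinIndep : LinIndepOn (_∈² Z) splitForms → LinIndep Z (splitSet Z L)
  LinIndepOn⇒LinIndep indep c vanish = indep c λ (x , y) (x∈Z , y∈Z) →
    trans (sym (lincomb≡lc (splitSet Z L) c x y)) (vanish x y x∈Z y∈Z)

  splitCoefficients : ∀ {P} → IsSplit Z P ⊎ Trivial Z P → (IsSplit Z P → InSys Z L P) → Fin (length (splitSet Z L)) → ℚ
  splitCoefficients {P} (inj₁ split) inSys = unit (proj₁ (splitSet-complete (proj₁ split) (inSys split)))
  splitCoefficients (inj₂ _) _ = λ _ → 0ℚ

  splitForm-inSpan : ∀ {P} (d : IsSplit Z P ⊎ Trivial Z P) inSys →
    ∀ p → p ∈² Z → splitForm P p ≡ lc (splitCoefficients d inSys) splitForms p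
  splitForm-inSpan {P} (inj₁ split) inSys (x , y) (x∈Z , y∈Z) =
    let i , Sᵢ~P = splitSet-complete (proj₁ split) (inSys split)
    in trans (sym (D-SameSplit Sᵢ~P x∈Z y∈Z)) (sym (unit-· i (λ j → splitForms j (x , y))))
  splitForm-inSpan (inj₂ trivial) _ (x , y) (x∈Z , y∈Z) =
    trans (D-Trivial trivial x∈Z y∈Z) (sym (·-zeroˡ (λ j → splitForms j (x , y))))

  setCoefficients : ∀ {P} → P ⊆ Z → (IsSplit Z P → InSys Z L P) → Fin (length (splitSet Z L)) → ℚ
  setCoefficients {P} P⊆Z = splitCoefficients (isSplit-or-trivial Z P P⊆Z)

  record Separator (a b : Fin N) : Set where
    field
      a∈Z      : a ∈ Z
      b∈Z      : b ∈ Z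
      a≢b      : a ≢ b
      side     : Subset N
      side⊆Z   : side ⊆ Z
      a∉side   : a ∉ side
      b∉side   : b ∉ side
      inSys-ab : IsSplit Z (side ∪ (⁅ a ⁆ ∪ ⁅ b ⁆)) → InSys Z L (side ∪ (⁅ a ⁆ ∪ ⁅ b ⁆))
      inSys-a  : IsSplit Z (side ∪ ⁅ a ⁆) → InSys Z L (side ∪ ⁅ a ⁆)
      inSys-b  : IsSplit Z (side ∪ ⁅ b ⁆) → InSys Z L (side ∪ ⁅ b ⁆)
      inSys-∅  : IsSplit Z side → InSys Z L side

    side∪a⊆Z : side ∪ ⁅ a ⁆ ⊆ Z
    side∪a⊆Z = ∪-least side⊆Z (x∈p⇒⁅x⁆⊆p a∈Z)

    side∪b⊆Z : side ∪ ⁅ b ⁆ ⊆ Z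
    side∪b⊆Z = ∪-least side⊆Z (x∈p⇒⁅x⁆⊆p b∈Z)

    side∪ab⊆Z : side ∪ (⁅ a ⁆ ∪ ⁅ b ⁆) ⊆ Z
    side∪ab⊆Z = ∪-least side⊆Z (∪-least (x∈p⇒⁅x⁆⊆p a∈Z) (x∈p⇒⁅x⁆⊆p b∈Z))

    coefficients-a coefficients-b coefficients-ab coefficients-∅ : Fin (length (splitSet Z L)) → ℚ
    coefficients-a  = setCoefficients side∪a⊆Z inSys-a
    coefficients-b  = setCoefficients side∪b⊆Z inSys-b
    coefficients-ab = setCoefficients side∪ab⊆Z inSys-ab
    coefficients-∅  = setCoefficients side⊆Z inSys-∅

    pairCoefficients : Fin (length (splitSet Z L)) → ℚ
    pairCoefficients i = quartet (coefficients-a i) (coefficients-b i) (coefficients-ab i) (coefficients-∅ i)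

    pairForm-inSpan : ∀ p → p ∈² Z → pairForm a b p ≡ lc pairCoefficients splitForms p
    pairForm-inSpan p@(x , y) p∈Z² = begin
      crossIndicator ⁅ a ⁆ ⁅ b ⁆ x y
        ≡⟨ quartet-D (∉⇒Disjoint-⁅⁆ a∉side) (∉⇒Disjoint-⁅⁆ b∉side) (≢⇒Disjoint-⁅⁆ a≢b) x y ⟨
      quartet (D (side ∪ ⁅ a ⁆) x y) (D (side ∪ ⁅ b ⁆) x y) (D (side ∪ (⁅ a ⁆ ∪ ⁅ b ⁆)) x y) (D side x y)
        ≡⟨ cong₂ (λ p q → quartet p q (D (side ∪ (⁅ a ⁆ ∪ ⁅ b ⁆)) x y) (D side x y))
                 (in-span side∪a⊆Z inSys-a) (in-span side∪b⊆Z inSys-b) ⟩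
      quartet (lc coefficients-a splitForms p) (lc coefficients-b splitForms p) (D (side ∪ (⁅ a ⁆ ∪ ⁅ b ⁆)) x y) (D side x y)
        ≡⟨ cong₂ (quartet (lc coefficients-a splitForms p) (lc coefficients-b splitForms p))
                 (in-span side∪ab⊆Z inSys-ab) (in-span side⊆Z inSys-∅) ⟩
      quartet (lc coefficients-a splitForms p) (lc coefficients-b splitForms p)
              (lc coefficients-ab splitForms p) (lc coefficients-∅ splitForms p)
        ≡⟨ ·-quartet coefficients-a coefficients-b coefficients-ab coefficients-∅ (λ i → splitForms i p) ⟨
      lc pairCoefficients splitForms p ∎
      where
      in-span : ∀ {P} (P⊆Z : P ⊆ Z) inSys → D P x y ≡ lc (setCoefficients P⊆Z inSys) splitForms p
      in-span {P} P⊆Z inSys = splitForm-inSpan (isSplit-or-trivial Z P P⊆Z) inSys p p∈Z²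

  separator : PairSep Z L → ∀ {a b} → a ∈ Z → b ∈ Z → a ≢ b → Separator a b
  separator separates {a} {b} a∈Z b∈Z a≢b with separates a b a∈Z b∈Z a≢b
  ... | A , B , _ , A∪B≡ , inSys-ab , inSys-a , inSys-b , inSys-∅ = record
    { a∈Z = a∈Z ; b∈Z = b∈Z ; a≢b = a≢b ; side = A ; side⊆Z = p∪q≡r-x-y⇒p⊆r A∪B≡ ; a∉side = a∉A ; b∉side = b∉A
    ; inSys-ab = inSys-ab ; inSys-a = inSys-a ; inSys-b = inSys-b ; inSys-∅ = inSys-∅ }
    where
    in-rest : ∀ {x} → x ∈ A → x ∈ Z - a - b
    in-rest x∈A = subst (_ ∈_) A∪B≡ (p⊆p∪q B x∈A)
    a∉A : a ∉ A
    a∉A a∈A = x∈p─q⇒x∉q (p─q⊆p (Z - a) ⁅ b ⁆ (in-rest a∈A)) (x∈⁅x⁆ a)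
    b∉A : b ∉ A
    b∉A b∈A = x∈p─q⇒x∉q (in-rest b∈A) (x∈⁅x⁆ b)

  PairSep⇒pairForm-inSpan : PairSep Z L → ∀ {a b} → a ∈ Z → b ∈ Z → a ≢ b → InSpanOn (_∈² Z) splitForms (pairForm a b)
  PairSep⇒pairForm-inSpan separates a∈Z b∈Z a≢b = pairCoefficients , pairForm-inSpan
    where open Separator (separator separates a∈Z b∈Z a≢b)

module _ (Y : Subset N) (L : List (Subset N)) where

  splitPart? : ∀ (T : Subset N) → Dec (Nonempty T × Nonempty (Y ─ T))
  splitPart? T = nonempty? T ×-dec nonempty? (Y ─ T)

  restrict-IsSplit : All (IsSplit Y) (restrict Y L)
  restrict-IsSplit = All.zip
    ( AllP.filter⁺ splitPart? (AllP.map⁺ (All.universal (λ A {x} → p∩q⊆q A Y {x}) L))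
    , AllP.all-filter splitPart? (map (_∩ Y) L))

  restrict-lift : ∀ {T} → T ∈ₗ restrict Y L → ∃ λ S → S ∈ₗ L × T ≡ S ∩ Y
  restrict-lift T∈ = ∈-map⁻ (_∩ Y) (proj₁ (∈-filter⁻ splitPart? T∈))

  InSys-restrict : ∀ {X P} → Y ⊆ X → InSys X L P → IsSplit Y (P ∩ Y) → InSys Y (restrict Y L) (P ∩ Y)
  InSys-restrict {P = P} Y⊆X P∈L P∩Y-split with find P∈L
  ... | S , S∈L , S~P = lose (∈-filter⁺ splitPart? (∈-map⁺ (_∩ Y) S∈L) (proj₂ S∩Y-split)) S∩Y~P∩Y
    where
    S∩Y~P∩Y : SameSplit Y (S ∩ Y) (P ∩ Y)
    S∩Y~P∩Y = SameSplit-∩ Y⊆X S~P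
    S∩Y-split : IsSplit Y (S ∩ Y)
    S∩Y-split = IsSplit-SameSplit (p∩q⊆q S Y) (SameSplit-sym (p∩q⊆q P Y) S∩Y~P∩Y) P∩Y-split

PairSep-restrict : ∀ {X Y : Subset N} {L} → Y ⊆ X → PairSep X L → PairSep Y (restrict Y L)
PairSep-restrict {X = X} {Y} {L} Y⊆X separates a b a∈Y b∈Y a≢b
  with separates a b (Y⊆X a∈Y) (Y⊆X b∈Y) a≢b
... | A , B , A∩B≡⊥ , A∪B≡ , splits-ab , splits-a , splits-b , splits =
  A ∩ Y , B ∩ Y , disjoint , union ,
  restricted (∪-least (x∈p⇒⁅x⁆⊆p a∈Y) (x∈p⇒⁅x⁆⊆p b∈Y)) splits-ab ,
  restricted (x∈p⇒⁅x⁆⊆p a∈Y) splits-a , restricted (x∈p⇒⁅x⁆⊆p b∈Y) splits-b ,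
  λ A∩Y-split → InSys-restrict Y L Y⊆X (splits (IsSplit-∩⇒IsSplit Y⊆X A⊆X A∩Y-split)) A∩Y-split
  where
  A⊆X : A ⊆ X
  A⊆X = p∪q≡r-x-y⇒p⊆r A∪B≡

  restricted : ∀ {S} → S ⊆ Y → (IsSplit X (A ∪ S) → InSys X L (A ∪ S)) →
    IsSplit Y ((A ∩ Y) ∪ S) → InSys Y (restrict Y L) ((A ∩ Y) ∪ S)
  restricted {S} S⊆Y splits-S split = subst (InSys Y (restrict Y L)) (∪-∩-absorb A S⊆Y)
    (InSys-restrict Y L Y⊆X (splits-S (IsSplit-∩⇒IsSplit Y⊆X (∪-least A⊆X (Y⊆X ∘ S⊆Y)) split′)) split′)
    where
    split′ : IsSplit Y ((A ∪ S) ∩ Y)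
    split′ = subst (IsSplit Y) (sym (∪-∩-absorb A S⊆Y)) split

  disjoint : (A ∩ Y) ∩ (B ∩ Y) ≡ ⊥
  disjoint = Empty-unique λ (i , i∈) →
    let i∈A∩Y , i∈B∩Y = x∈p∩q⁻ (A ∩ Y) (B ∩ Y) i∈
    in ∉⊥ (subst (i ∈_) A∩B≡⊥ (x∈p∩q⁺ (proj₁ (x∈p∩q⁻ A Y i∈A∩Y) , proj₁ (x∈p∩q⁻ B Y i∈B∩Y))))

  union : (A ∩ Y) ∪ (B ∩ Y) ≡ Y - a - b
  union = begin
    (A ∩ Y) ∪ (B ∩ Y)          ≡⟨ ∩-distribʳ-∪ Y A B ⟨
    (A ∪ B) ∩ Y                ≡⟨ cong (_∩ Y) A∪B≡ ⟩
    (X - a - b) ∩ Y            ≡⟨ cong (_∩ Y) (p─q─r≡p─q∪r X ⁅ a ⁆ ⁅ b ⁆) ⟩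
    (X ─ (⁅ a ⁆ ∪ ⁅ b ⁆)) ∩ Y  ≡⟨ p─r∩q≡q─r (⁅ a ⁆ ∪ ⁅ b ⁆) Y⊆X ⟩
    Y ─ (⁅ a ⁆ ∪ ⁅ b ⁆)        ≡⟨ p─q─r≡p─q∪r Y ⁅ a ⁆ ⁅ b ⁆ ⟨
    Y - a - b                  ∎

-- Deleting a point

module RestrictionIndependence {N} {X : Subset N} {L : List (Subset N)} (L⊆X : All (_⊆ X) L)
  (indep : LinIndepOn (_∈² X) (splitForms X L)) (separates : PairSep X L) {y : Fin N} (y∈X : y ∈ X) where

  Y : Subset N
  Y = X - y

  Y⊆X : Y ⊆ X
  Y⊆X = p─q⊆p X ⁅ y ⁆

  S : Fin (length (splitSet X L)) → Subset N
  S = List.lookup (splitSet X L)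

  R : Fin (length (splitSet Y (restrict Y L))) → Subset N
  R = List.lookup (splitSet Y (restrict Y L))

  R-split : ∀ t → IsSplit Y (R t)
  R-split t = All.lookup (AllP.deduplicate⁺ (sameSplit? Y) (restrict-IsSplit Y L)) (∈-lookup t)

  R⊆Y : ∀ t → R t ⊆ Y
  R⊆Y t = proj₁ (R-split t)

  lifting : ∀ t → ∃ λ i → SameSplit Y (S i ∩ Y) (R t)
  lifting t with restrict-lift Y L (∈-deduplicate⁻ (sameSplit? Y) (restrict Y L) (∈-lookup t))
  ... | P , P∈L , Rₜ≡P∩Y with splitSet-complete X L (All.lookup L⊆X P∈L) (lose P∈L (inj₁ refl))
  ...   | i , Sᵢ~P = i , subst (SameSplit Y (S i ∩ Y)) (sym Rₜ≡P∩Y) (SameSplit-∩ Y⊆X Sᵢ~P)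

  lift : Fin (length (splitSet Y (restrict Y L))) → Fin (length (splitSet X L))
  lift t = proj₁ (lifting t)

  restrictedClass : Subset N → Fin (length (splitSet Y (restrict Y L))) → ℚ
  restrictedClass P t = indicator (does (sameSplit? Y (P ∩ Y) (R t)))

  restrictedClass-∪⁅y⁆ : ∀ P t → restrictedClass (P ∪ ⁅ y ⁆) t ≡ restrictedClass P t
  restrictedClass-∪⁅y⁆ P t = cong (λ Q → indicator (does (sameSplit? Y Q (R t)))) (p∪⁅x⁆∩q-x≡p∩q-x P X y)

  -- The linear functional summing the coefficients of those splits of X that restrict to R t.
  fibre : Fin (length (splitSet Y (restrict Y L))) → Fin (length (splitSet X L)) → ℚ
  fibre t i = restrictedClass (S i) t

  fibre-lift : ∀ t₀ t → fibre t₀ (lift t) ≡ unit t₀ t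
  fibre-lift t₀ t = cong indicator (does-⇔ (mk⇔ to from) (sameSplit? Y (S (lift t) ∩ Y) (R t₀)) (t₀ ≟ t))
    where
    to : SameSplit Y (S (lift t) ∩ Y) (R t₀) → t₀ ≡ t
    to lift~Rₜ₀ = sym (splitSet-distinct Y (restrict Y L) (All.map proj₁ (restrict-IsSplit Y L))
      (Equivalence.to (SameSplit-transfer (R⊆Y t) (R⊆Y t₀) (proj₂ (lifting t))) lift~Rₜ₀))
    from : t₀ ≡ t → SameSplit Y (S (lift t) ∩ Y) (R t₀)
    from refl = proj₂ (lifting t₀)

  fibre-splitCoefficients : ∀ {P} (d : IsSplit X P ⊎ Trivial X P) inSys t →
    splitCoefficients X L d inSys · fibre t ≡ restrictedClass P t
  fibre-splitCoefficients {P} (inj₁ split) inSys t =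
    let i , Sᵢ~P = splitSet-complete X L (proj₁ split) (inSys split)
    in trans (unit-· i (fibre t)) (cong indicator (does-⇔
         (SameSplit-transfer (p∩q⊆q P Y) (R⊆Y t) (SameSplit-∩ Y⊆X Sᵢ~P))
         (sameSplit? Y (S i ∩ Y) (R t)) (sameSplit? Y (P ∩ Y) (R t))))
  fibre-splitCoefficients {P} (inj₂ trivial) inSys t =
    trans (·-zeroˡ (fibre t)) (sym (cong indicator (dec-false (sameSplit? Y (P ∩ Y) (R t)) P∩Y≁Rₜ)))
    where
    P∩Y≁Rₜ : ¬ SameSplit Y (P ∩ Y) (R t)
    P∩Y≁Rₜ P∩Y~Rₜ = Trivial⇒¬IsSplit (Trivial-∩ Y⊆X trivial)
      (IsSplit-SameSplit (p∩q⊆q P Y) (SameSplit-sym (R⊆Y t) P∩Y~Rₜ) (R-split t))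

  fibre-setCoefficients : ∀ {P} (P⊆X : P ⊆ X) inSys t → setCoefficients X L P⊆X inSys · fibre t ≡ restrictedClass P t
  fibre-setCoefficients {P} P⊆X = fibre-splitCoefficients (isSplit-or-trivial X P P⊆X)

  separatorWith-y : ∀ {x} → x ∈ Y → Separator X L x y
  separatorWith-y x∈Y = separator X L separates (Y⊆X x∈Y) y∈X (x∉⁅y⁆⇒x≢y (x∈p─q⇒x∉q x∈Y))

  pairCoefficientsWith-y : Fin N → Fin (length (splitSet X L)) → ℚ
  pairCoefficientsWith-y x with x ∈? Y
  ... | yes x∈Y = Separator.pairCoefficients (separatorWith-y x∈Y)
  ... | no _    = λ _ → 0ℚ

  pairForm-y-inSpan : ∀ x p → p ∈² X →
    indicator (lookup Y x) * pairForm x y p ≡ lc (pairCoefficientsWith-y x) (splitForms X L) p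
  pairForm-y-inSpan x p p∈X² with x ∈? Y
  ... | yes x∈Y = trans (cong (λ b → indicator b * pairForm x y p) (∈⇒lookup x∈Y))
                        (trans (ℚP.*-identityˡ (pairForm x y p)) (Separator.pairForm-inSpan (separatorWith-y x∈Y) p p∈X²))
  ... | no x∉Y  = trans (cong (λ b → indicator b * pairForm x y p) (∉⇒lookup x∉Y))
                        (trans (ℚP.*-zeroˡ (pairForm x y p)) (sym (·-zeroˡ (λ i → splitForms X L i p))))

  -- Adding y does not change the restriction to Y, so the four terms of the quartet cancel in pairs.
  fibre-pairCoefficientsWith-y : ∀ x t → pairCoefficientsWith-y x · fibre t ≡ 0ℚ
  fibre-pairCoefficientsWith-y x t with x ∈? Y
  ... | no _    = ·-zeroˡ (fibre t)
  ... | yes x∈Y = begin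
    pairCoefficients · fibre t
      ≡⟨ ·-quartet coefficients-a coefficients-b coefficients-ab coefficients-∅ (fibre t) ⟩
    quartet (coefficients-a · fibre t) (coefficients-b · fibre t) (coefficients-ab · fibre t) (coefficients-∅ · fibre t)
      ≡⟨ cong₂ (quartet (coefficients-a · fibre t) (coefficients-b · fibre t)) ab≡a ∅≡b ⟩
    quartet (coefficients-a · fibre t) (coefficients-b · fibre t) (coefficients-a · fibre t) (coefficients-b · fibre t)
      ≡⟨ quartet-cancel (coefficients-a · fibre t) (coefficients-b · fibre t) ⟩
    0ℚ ∎
    where
    open Separator (separatorWith-y x∈Y)
    ab≡a : coefficients-ab · fibre t ≡ coefficients-a · fibre t
    ab≡a = begin
      coefficients-ab · fibre t                       ≡⟨ fibre-setCoefficients _ inSys-ab t ⟩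
      restrictedClass (side ∪ (⁅ x ⁆ ∪ ⁅ y ⁆)) t      ≡⟨ cong (λ P → restrictedClass P t) (sym (∪-assoc side ⁅ x ⁆ ⁅ y ⁆)) ⟩
      restrictedClass ((side ∪ ⁅ x ⁆) ∪ ⁅ y ⁆) t      ≡⟨ restrictedClass-∪⁅y⁆ (side ∪ ⁅ x ⁆) t ⟩
      restrictedClass (side ∪ ⁅ x ⁆) t                ≡⟨ fibre-setCoefficients _ inSys-a t ⟨
      coefficients-a · fibre t                        ∎
    ∅≡b : coefficients-∅ · fibre t ≡ coefficients-b · fibre t
    ∅≡b = begin
      coefficients-∅ · fibre t                        ≡⟨ fibre-setCoefficients _ inSys-∅ t ⟩
      restrictedClass side t                          ≡⟨ restrictedClass-∪⁅y⁆ side t ⟨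
      restrictedClass (side ∪ ⁅ y ⁆) t                ≡⟨ fibre-setCoefficients _ inSys-b t ⟨
      coefficients-b · fibre t                        ∎

  restrict-linIndep : LinIndepOn (_∈² Y) (splitForms Y (restrict Y L))
  restrict-linIndep c vanish t₀ = begin
    c t₀                                             ≡⟨ trans (·-comm c (unit t₀)) (unit-· t₀ c) ⟨
    c · unit t₀                                      ≡⟨ ·-congʳ c (λ t → trans (unit-· (lift t) (fibre t₀)) (fibre-lift t₀ t)) ⟨
    c · (λ t → unit (lift t) · fibre t₀)             ≡⟨ ·ᴹ-assoc c (λ t → unit (lift t)) (fibre t₀) ⟨
    a · fibre t₀                                     ≡⟨ ·-congˡ (fibre t₀) a≡b ⟩
    b · fibre t₀                                     ≡⟨ ·ᴹ-assoc hy pairCoefficientsWith-y (fibre t₀) ⟩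
    hy · (λ x → pairCoefficientsWith-y x · fibre t₀) ≡⟨ ·-congʳ hy (λ x → fibre-pairCoefficientsWith-y x t₀) ⟩
    hy · (λ _ → 0ℚ)                                  ≡⟨ ·-zeroʳ hy ⟩
    0ℚ                                               ∎
    where
    a : Fin (length (splitSet X L)) → ℚ
    a = c ·ᴹ λ t → unit (lift t)

    h : Form N
    h = lc a (splitForms X L)

    hy : Fin N → ℚ
    hy x = h (x , y)

    b : Fin (length (splitSet X L)) → ℚ
    b = hy ·ᴹ pairCoefficientsWith-y

    h-vanishes : ∀ p → p ∈² Y → h p ≡ 0ℚ
    h-vanishes p@(u , v) (u∈Y , v∈Y) = begin
      h p                                                ≡⟨ ·ᴹ-assoc c (λ t → unit (lift t)) (λ i → splitForms X L i p) ⟩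
      c · (λ t → unit (lift t) · λ i → splitForms X L i p) ≡⟨ ·-congʳ c (λ t → unit-· (lift t) (λ i → splitForms X L i p)) ⟩
      c · (λ t → D (S (lift t)) u v)                     ≡⟨ ·-congʳ c (λ t → D-∩ (S (lift t)) u∈Y v∈Y) ⟨
      c · (λ t → D (S (lift t) ∩ Y) u v)                 ≡⟨ ·-congʳ c (λ t → D-SameSplit (proj₂ (lifting t)) u∈Y v∈Y) ⟩
      lc c (splitForms Y (restrict Y L)) p               ≡⟨ vanish p (u∈Y , v∈Y) ⟩
      0ℚ                                                 ∎

    h-decomposes : ∀ p → p ∈² X → h p ≡ lc b (splitForms X L) p
    h-decomposes p p∈X² = begin
      h p
        ≡⟨ form-decomposition X y h (λ u v → ·-congʳ a (λ i → D-sym (S i) u v))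
             (λ u → trans (·-congʳ a (λ i → D-diag (S i) u)) (·-zeroʳ a)) h-vanishes p p∈X² ⟩
      (λ x → hy x * indicator (lookup Y x)) · (λ x → pairForm x y p)
        ≡⟨ ·-*-assoc hy (λ x → indicator (lookup Y x)) (λ x → pairForm x y p) ⟩
      hy · (λ x → indicator (lookup Y x) * pairForm x y p)
        ≡⟨ ·-congʳ hy (λ x → pairForm-y-inSpan x p p∈X²) ⟩
      hy · (λ x → pairCoefficientsWith-y x · λ i → splitForms X L i p)
        ≡⟨ ·ᴹ-assoc hy pairCoefficientsWith-y (λ i → splitForms X L i p) ⟨
      lc b (splitForms X L) p ∎

    a≡b : ∀ i → a i ≡ b i
    a≡b = linIndep⇒coefficients-unique indep h-decomposes

∣p∣≡1+∣p-x∣ : ∀ {p : Subset N} {x} → x ∈ p → ∣ p ∣ ≡ suc ∣ p - x ∣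
∣p∣≡1+∣p-x∣ {p = true ∷ p}  here        = cong suc (cong ∣_∣ (sym (p─⊥≡p p)))
∣p∣≡1+∣p-x∣ {p = true ∷ p}  (there x∈p) = cong suc (∣p∣≡1+∣p-x∣ x∈p)
∣p∣≡1+∣p-x∣ {p = false ∷ p} (there x∈p) = ∣p∣≡1+∣p-x∣ x∈p

nC2-positive : ∀ {n} → 2 ≤ n → 1 ≤ n C 2
nC2-positive {suc zero} (s≤s ())
nC2-positive {suc (suc m)} _ = subst (1 ≤_) (nCk+nC[k+1]≡[n+1]C[k+1] (suc m) 1)
  (subst (λ k → 1 ≤ k ℕ.+ suc m C 2) (sym (nC1≡n (suc m))) (s≤s z≤n))

restrict-maxLinIndep : ∀ {X : Subset N} {L y} → All (IsSplit X) L → LinIndep X (splitSet X L) → PairSep X L → y ∈ X →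
  MaxLinIndep (X - y) (restrict (X - y) L)
restrict-maxLinIndep {N} {X} {L} {y} L-splits L-indep separates y∈X =
  LinIndepOn⇒LinIndep Y (restrict Y L) R-indep , ℕP.≤-antisym upper lower
  where
  Y : Subset N
  Y = X - y

  R : Fin (length (splitSet Y (restrict Y L))) → Subset N
  R = List.lookup (splitSet Y (restrict Y L))

  R-indep : LinIndepOn (_∈² Y) (splitForms Y (restrict Y L))
  R-indep = RestrictionIndependence.restrict-linIndep
    (All.map proj₁ L-splits) (LinIndep⇒LinIndepOn X L L-indep) separates y∈X

  upper : length (splitSet Y (restrict Y L)) ≤ ∣ Y ∣ C 2
  upper = symmetricForms-linIndep⇒≤ R-indep (λ t → D-sym (R t)) (λ t → D-diag (R t))

  lower : ∣ Y ∣ C 2 ≤ length (splitSet Y (restrict Y L))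
  lower = pairForms-inSpan⇒≤ (PairSep⇒pairForm-inSpan Y (restrict Y L) (PairSep-restrict (p─q⊆p X ⁅ y ⁆) separates))

lemma4 : (N : ℕ) (X : Subset N) → 3 ≤ ∣ X ∣ → (L : List (Subset N)) →
  SplitSystem X L → MaxLinIndep X L → PairSep X L →
  (y : Fin N) → y ∈ X →
  SplitSystem (X - y) (restrict (X - y) L) × MaxLinIndep (X - y) (restrict (X - y) L)
    × PairSep (X - y) (restrict (X - y) L)
lemma4 N X 3≤∣X∣ L (L-splits , _) (L-indep , _) separates y y∈X =
  (restrict-IsSplit (X - y) L , restriction≢[]) , maxIndep , PairSep-restrict (p─q⊆p X ⁅ y ⁆) separates
  where
  maxIndep : MaxLinIndep (X - y) (restrict (X - y) L)
  maxIndep = restrict-maxLinIndep L-splits L-indep separates y∈X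

  restriction≢[] : restrict (X - y) L ≢ []
  restriction≢[] R≡[] = ℕP.<⇒≢ (nC2-positive (ℕP.≤-pred (subst (3 ≤_) (∣p∣≡1+∣p-x∣ y∈X) 3≤∣X∣)))
    (subst (λ R → length (splitSet (X - y) R) ≡ ∣ X - y ∣ C 2) R≡[] (proj₂ maxIndep))
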